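{- Let $\mathcal{Y}\subseteq\mathbb{R}$, $f:\mathcal{U}^*\to\mathcal{Y}$, and $\ell,h\in\mathbb{Z}$ with $h\ge\ell$. Then: 1. $\mathrm{stab}_{\ell,h}f(u)\ge\mathrm{stab}_{\ell,h+1}f(u)$ for all $u\in\mathcal{U}^*$. 2. If $u,v\in\mathcal{U}^*$ are neighbors with $v\subset u$, then $\mathrm{stab}_{\ell,h+1}f(u)-1\le\mathrm{stab}_{\ell,h}f(v)\le\mathrm{stab}_{\ell,h}f(u)$. 3. Let $u\in\mathcal{U}^*$ with $h\le|u|$. If the restriction of $f$ to the domain $\mathrm{DN}_{|u|-\ell}(u)$ is Lipschitz and monotone, then $\mathrm{stab}_{\ell,h}f(u)=f(u)$.
   Context: $\mathcal{U}^*$ is the set of finite subsets of a countable set $\mathcal{U}$; $x,y$ are neighbors if one is obtained from the other by inserting one element. $\mathrm{DN}_\lambda(x)=\{z\subseteq x:|x\setminus z|\le\lambda\}$. $f$ is Lipschitz over a domain $D$ if $|f(x)-f(y)|\le1$ for all neighbors $x,y\in D$; monotone over $D$ if $f(x)\le f(y)$ for $x\subset y$ in $D$. For $\ell\in\mathbb{Z}$, a set $x\in\mathcal{U}^*$ is $\ell$-stable with respect to $f$ if $|x|\ge\ell$ and $f$ is Lipschitz over $\{x'\subseteq x:|x'|\ge\ell\}$. For $\ell,h\in\mathbb{Z}$, $S_{\ell,h}(x)=\{x'\subseteq x:|x'|\ge h\text{ and }x'\text{ is }\ell\text{ -stable w.r.t. }f\}$, and $\mathrm{stab}_{\ell,h}f(x)=\max\big(\{f(x'):x'\in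 S_{\ell,h}(x)\}\cup\{\inf\mathcal{Y}\}\big)$, with the convention $\inf\mathcal{Y}=-\infty$ if $\mathcal{Y}$ is unbounded below. -}

module Defs where

open import Data.Nat as ℕ using (ℕ)
open import Data.Integer as ℤ using (ℤ; +_)
open import Data.List using (List; length; filter)
open import Data.List.Relation.Unary.Linked using (Linked)
open import Data.List.Membership.Propositional using (_∈_; _∉_)
open import Data.List.Membership.DecPropositional ℕ._≟_ using (_∈?_)
open import Data.Product using (Σ; ∃; ∃-syntax; _×_)
open import Data.Sum using (_⊎_)
open import Relation.Nullary using (¬_; ¬?)
open import Relation.Binary.PropositionalEquality using (_≡_)
open import Relation.Binary.Structures using (IsTotalOrder)
open import Algebra.Structures using (IsAbelianGroup)
open import Function.Bundles using (_⇔_)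

-- The universe 𝒰 (countable) is taken to be ℕ.
-- 𝒰* : finite subsets of ℕ, represented canonically as strictly
-- increasing lists (so that equal sets are equal values).

record FinSet : Set where
  constructor mkFinSet
  field
    elems  : List ℕ
    sorted : Linked ℕ._<_ elems
open FinSet public

infix 4 _∈ₛ_ _∉ₛ_ _⊆ₛ_ _⊂ₛ_

_∈ₛ_ : ℕ → FinSet → Set
a ∈ₛ x = a ∈ elems x

_∉ₛ_ : ℕ → FinSet → Set
a ∉ₛ x = a ∉ elems x

∣_∣ₛ : FinSet → ℕ
∣ x ∣ₛ = length (elems x)

_⊆ₛ_ : FinSet → FinSet → Set
x ⊆ₛ y = ∀ a → a ∈ₛ x → a ∈ₛ y

_⊂ₛ_ : FinSet → FinSet → Set
x ⊂ₛ y = x ⊆ₛ y × ∃[ a ] (a ∈ₛ y × a ∉ₛ x)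

∣_∖_∣ₛ : FinSet → FinSet → ℕ
∣ x ∖ z ∣ₛ = length (filter (λ a → ¬? (a ∈? elems z)) (elems x))

Inserts : FinSet → FinSet → Set
Inserts x y = ∃[ a ] (a ∉ₛ x × (∀ b → (b ∈ₛ y) ⇔ (b ∈ₛ x ⊎ b ≡ a)))

Neighbors : FinSet → FinSet → Set
Neighbors x y = Inserts x y ⊎ Inserts y x

DN : ℤ → FinSet → FinSet → Set
DN λ' x z = z ⊆ₛ x × (+ ∣ x ∖ z ∣ₛ) ℤ.≤ λ'

-- Value domain: ℝ is abstracted to an arbitrary totally ordered
-- abelian group with a distinguished element 1 > 0 (ℝ is an instance).

record OrderedGroup : Set₁ where
  field
    R       : Set
    _+_     : R → R → R
    0#      : R
    -_      : R → R
    1#      : R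
    _≤_     : R → R → Set
    isAbelianGroup : IsAbelianGroup _≡_ _+_ 0# -_
    isTotalOrder   : IsTotalOrder _≡_ _≤_
    +-monoˡ-≤ : ∀ {a b} c → a ≤ b → (a + c) ≤ (b + c)
    0≤1     : 0# ≤ 1#
    0≢1     : ¬ (0# ≡ 1#)

  _-_ : R → R → R
  a - b = a + (- b)

  Dist≤1 : R → R → Set
  Dist≤1 a b = ((a - b) ≤ 1#) × ((b - a) ≤ 1#)

  data Ext : Set where
    -∞  : Ext
    fin : R → Ext

  data _≤ₑ_ : Ext → Ext → Set where
    -∞≤     : ∀ {e} → -∞ ≤ₑ e
    fin≤fin : ∀ {a b} → a ≤ b → fin a ≤ₑ fin b

  _-1ₑ : Ext → Ext
  -∞ -1ₑ    = -∞
  (fin a) -1ₑ = fin (a - 1#)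

  -- i is the infimum of 𝒴 in R ∪ {-∞} (so i = -∞ iff 𝒴 is unbounded below)
  IsInf : (R → Set) → Ext → Set
  IsInf 𝒴 i = (∀ y → 𝒴 y → i ≤ₑ fin y)
            × (∀ e → (∀ y → 𝒴 y → e ≤ₑ fin y) → e ≤ₑ i)

  module _ (f : FinSet → R) where

    LipschitzOver : (FinSet → Set) → Set
    LipschitzOver D = ∀ x y → D x → D y → Neighbors x y → Dist≤1 (f x) (f y)

    MonotoneOver : (FinSet → Set) → Set
    MonotoneOver D = ∀ x y → D x → D y → x ⊂ₛ y → f x ≤ f y

    Stable : ℤ → FinSet → Set
    Stable ℓ x = ℓ ℤ.≤ (+ ∣ x ∣ₛ)
               × LipschitzOver (λ x' → x' ⊆ₛ x × ℓ ℤ.≤ (+ ∣ x' ∣ₛ))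

    S : ℤ → ℤ → FinSet → FinSet → Set
    S ℓ h x x' = x' ⊆ₛ x × h ℤ.≤ (+ ∣ x' ∣ₛ) × Stable ℓ x'

    -- s = stab_{ℓ,h} f (x), where infY = inf 𝒴:
    -- s is the maximum of { f x' : x' ∈ S_{ℓ,h}(x) } ∪ { infY }.
    IsStab : Ext → ℤ → ℤ → FinSet → Ext → Set
    IsStab infY ℓ h x s =
        (s ≡ infY ⊎ ∃[ x' ] (S ℓ h x x' × s ≡ fin (f x')))
      × infY ≤ₑ s
      × (∀ x' → S ℓ h x x' → fin (f x') ≤ₑ s)

-- Everything is a comparison of maxima over the families S_{ℓ,h}.  Raising h or
-- shrinking the ambient set only shrinks the family, which gives part 1 and the upper
-- bound of part 2.  For the lower bound, a stable x′ ⊆ u of size ≥ h + 1 either avoids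
-- the element of u ∖ v, or deleting that element leaves a member of S_{ℓ,h}(v) on which
-- f drops by at most 1, because x′ is stable.  For part 3, the DN_{|u|−ℓ}(u) hypotheses
-- say exactly that u is ℓ-stable and that f u dominates f on all of S_{ℓ,h}(u).
module Submission where

open import Defs
open import Algebra.Structures using (IsAbelianGroup)
open import Data.Empty using (⊥-elim)
import Data.Integer as ℤ
import Data.Integer.Properties as ℤP
open import Data.Integer.Tactic.RingSolver using (solve-∀)
open import Data.Nat as ℕ using (ℕ; suc; z≤n; s≤s)
open import Data.List using (List; []; _∷_; length; filter)
open import Data.List.Membership.DecPropositional ℕ._≟_ using (_∈?_; _∉?_)
open import Data.List.Membership.Propositional using (_∈_; find)
open import Data.List.Membership.Propositional.Properties using (∈-filter⁺; ∈-filter⁻)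
open import Data.List.Properties using (filter-accept; filter-reject; filter-all)
open import Data.List.Relation.Binary.Sublist.Heterogeneous.Properties using (length-mono-≤)
open import Data.List.Relation.Binary.Sublist.Propositional using (⊆-refl)
import Data.List.Relation.Binary.Sublist.Propositional.Properties as Sublist
open import Data.List.Relation.Unary.All as All using (All)
open import Data.List.Relation.Unary.Any as Any using (here; there; any?)
open import Data.List.Relation.Unary.Linked as Linked using (Linked; _∷_)
open import Data.List.Relation.Unary.Linked.Properties as LinkedP using (Linked⇒All)
import Data.Nat.Properties as ℕP
open import Data.Product using (_×_; ∃-syntax; _,_; proj₁; proj₂)
open import Data.Sum using (_⊎_; inj₁; inj₂)
open import Function.Bundles using (_⇔_; Equivalence; mk⇔)
open import Relation.Binary.PropositionalEquality
  using (_≡_; _≢_; refl; sym; trans; cong; subst; subst₂; module ≡-Reasoning)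
open import Relation.Binary.Structures using (IsTotalOrder)
open import Relation.Nullary using (Dec; ¬?; yes; no)
open import Relation.Nullary.Decidable using (decidable-stable)

Sorted : List ℕ → Set
Sorted = Linked ℕ._<_

sorted-head<∈tail : ∀ {a c xs} → Sorted (a ∷ xs) → c ∈ xs → a ℕ.< c
sorted-head<∈tail (a<b ∷ s) = All.lookup (Linked⇒All ℕP.<-trans a<b s)

sorted-head≤∈ : ∀ {a c xs} → Sorted (a ∷ xs) → c ∈ a ∷ xs → a ℕ.≤ c
sorted-head≤∈ s (here refl) = ℕP.≤-refl
sorted-head≤∈ s (there c∈) = ℕP.<⇒≤ (sorted-head<∈tail s c∈)

sorted-⊆-antisym : ∀ {xs ys} → Sorted xs → Sorted ys →
  (∀ c → c ∈ xs → c ∈ ys) → (∀ c → c ∈ ys → c ∈ xs) → xs ≡ ys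
sorted-⊆-antisym {[]} {[]} _ _ _ _ = refl
sorted-⊆-antisym {[]} {y ∷ _} _ _ _ ys⊆ with ys⊆ y (here refl)
... | ()
sorted-⊆-antisym {x ∷ _} {[]} _ _ xs⊆ _ with xs⊆ x (here refl)
... | ()
sorted-⊆-antisym {x ∷ xs} {y ∷ ys} sx sy xs⊆ ys⊆
  with ℕP.≤-antisym (sorted-head≤∈ sx (ys⊆ y (here refl))) (sorted-head≤∈ sy (xs⊆ x (here refl)))
... | refl = cong (x ∷_)
  (sorted-⊆-antisym (Linked.tail sx) (Linked.tail sy) (tail-⊆ sx xs⊆) (tail-⊆ sy ys⊆))
  where
  tail-⊆ : ∀ {zs ws} → Sorted (x ∷ zs) → (∀ c → c ∈ x ∷ zs → c ∈ x ∷ ws) → ∀ c → c ∈ zs → c ∈ ws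
  tail-⊆ s ⊆ c c∈ = Any.tail (ℕP.>⇒≢ (sorted-head<∈tail s c∈)) (⊆ c (there c∈))

FinSet-≡ : ∀ {x y} → elems x ≡ elems y → x ≡ y
FinSet-≡ {mkFinSet xs p} {mkFinSet .xs q} refl =
  cong (mkFinSet xs) (Linked.irrelevant ℕP.<-irrelevant p q)

⊆ₛ-refl : ∀ {x} → x ⊆ₛ x
⊆ₛ-refl _ c∈ = c∈

⊆ₛ-trans : ∀ {x y z} → x ⊆ₛ y → y ⊆ₛ z → x ⊆ₛ z
⊆ₛ-trans x⊆y y⊆z c c∈ = y⊆z c (x⊆y c c∈)

⊆ₛ-antisym : ∀ {x y} → x ⊆ₛ y → y ⊆ₛ x → x ≡ y
⊆ₛ-antisym {x} {y} x⊆y y⊆x = FinSet-≡ (sorted-⊆-antisym (sorted x) (sorted y) x⊆y y⊆x)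

⊆ₛ⇒≡⊎⊂ₛ : ∀ {x y} → x ⊆ₛ y → x ≡ y ⊎ x ⊂ₛ y
⊆ₛ⇒≡⊎⊂ₛ {x} {y} x⊆y with any? (_∉? elems x) (elems y)
... | yes new = let (a , a∈y , a∉x) = find new in inj₂ (x⊆y , a , a∈y , a∉x)
... | no ¬new = inj₁ (⊆ₛ-antisym x⊆y λ a a∈y →
        decidable-stable (a ∈? elems x) (λ a∉x → ¬new (Any.map (λ { refl → a∉x }) a∈y)))

sorted-tail≢head : ∀ {a xs} → Sorted (a ∷ xs) → All (_≢ a) xs
sorted-tail≢head s = All.tabulate λ c∈ → ℕP.>⇒≢ (sorted-head<∈tail s c∈)

_≢?_ : (c a : ℕ) → Dec (c ≢ a)
c ≢? a = ¬? (c ℕ.≟ a)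

without : ℕ → List ℕ → List ℕ
without a = filter (_≢? a)

length-without : ∀ {a xs} → Sorted xs → a ∈ xs → length xs ℕ.≤ suc (length (without a xs))
length-without {a} {a ∷ xs} s (here refl)
  rewrite filter-reject (_≢? a) {xs = xs} (λ a≢a → a≢a refl)
        | filter-all (_≢? a) (sorted-tail≢head s) = ℕP.≤-refl
length-without {a} {b ∷ xs} s (there a∈xs)
  rewrite filter-accept (_≢? a) {xs = xs} (ℕP.<⇒≢ (sorted-head<∈tail s a∈xs)) =
  s≤s (length-without (Linked.tail s) a∈xs)

remove : ℕ → FinSet → FinSet
remove a x = mkFinSet (without a (elems x)) (LinkedP.filter⁺ (_≢? a) ℕP.<-trans (sorted x))

remove-⊆ : ∀ {a} x → remove a x ⊆ₛ x
remove-⊆ {a} x c c∈ = proj₁ (∈-filter⁻ (_≢? a) {xs = elems x} c∈)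

∉-remove : ∀ {a} x → a ∉ₛ remove a x
∉-remove {a} x a∈ = proj₂ (∈-filter⁻ (_≢? a) {xs = elems x} a∈) refl

∣remove∣ : ∀ {a} x → a ∈ₛ x → ∣ x ∣ₛ ℕ.≤ suc ∣ remove a x ∣ₛ
∣remove∣ x = length-without (sorted x)

remove-Inserts : ∀ {a} x → a ∈ₛ x → Inserts (remove a x) x
remove-Inserts {a} x a∈x = a , ∉-remove x , λ c → mk⇔ (split c) (unsplit c)
  where
  split : ∀ c → c ∈ₛ x → c ∈ₛ remove a x ⊎ c ≡ a
  split c c∈ with c ℕ.≟ a
  ... | yes c≡a = inj₂ c≡a
  ... | no c≢a = inj₁ (∈-filter⁺ (_≢? a) c∈ c≢a)
  unsplit : ∀ c → c ∈ₛ remove a x ⊎ c ≡ a → c ∈ₛ x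
  unsplit c (inj₁ c∈) = remove-⊆ x c c∈
  unsplit c (inj₂ refl) = a∈x

Neighbors-⊂ₛ⇒Inserts : ∀ {u v} → Neighbors u v → v ⊂ₛ u → Inserts v u
Neighbors-⊂ₛ⇒Inserts (inj₂ v+a≡u) _ = v+a≡u
Neighbors-⊂ₛ⇒Inserts (inj₁ (a , a∉u , u+a≡v)) (v⊆u , _) =
  ⊥-elim (a∉u (v⊆u a (Equivalence.from (u+a≡v a) (inj₂ refl))))

⊆-Inserts⁻ : ∀ {u v x a} → (∀ c → (c ∈ₛ u) ⇔ (c ∈ₛ v ⊎ c ≡ a)) → x ⊆ₛ u → a ∉ₛ x → x ⊆ₛ v
⊆-Inserts⁻ u≡v+a x⊆u a∉x c c∈x with Equivalence.to (u≡v+a c) (x⊆u c c∈x)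
... | inj₁ c∈v = c∈v
... | inj₂ refl = ⊥-elim (a∉x c∈x)

_∖ₗ_ : List ℕ → List ℕ → List ℕ
xs ∖ₗ zs = filter (_∉? zs) xs

length-∖ₗ-antitone : ∀ xs {ys zs} → (∀ c → c ∈ ys → c ∈ zs) →
  length (xs ∖ₗ zs) ℕ.≤ length (xs ∖ₗ ys)
length-∖ₗ-antitone xs {ys} {zs} ys⊆zs = length-mono-≤
  (Sublist.filter⁺ (_∉? zs) (_∉? ys)
    (λ { refl c∉zs c∈ys → c∉zs (ys⊆zs _ c∈ys) }) (⊆-refl {x = xs}))

length-∖ₗ+∣∣≤ : ∀ xs z → (∀ c → c ∈ₛ z → c ∈ xs) → length (xs ∖ₗ elems z) ℕ.+ ∣ z ∣ₛ ℕ.≤ length xs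
length-∖ₗ+∣∣≤ [] (mkFinSet [] _) _ = z≤n
length-∖ₗ+∣∣≤ [] (mkFinSet (c ∷ _) _) z⊆[] with z⊆[] c (here refl)
... | ()
length-∖ₗ+∣∣≤ (a ∷ xs) z z⊆ with a ∈? elems z
... | no a∉z =
  s≤s (length-∖ₗ+∣∣≤ xs z λ c c∈z → Any.tail (λ { refl → a∉z c∈z }) (z⊆ c c∈z))
... | yes a∈z = begin
  length (xs ∖ₗ elems z) ℕ.+ ∣ z ∣ₛ
    ≤⟨ ℕP.+-mono-≤ (length-∖ₗ-antitone xs (remove-⊆ z)) (∣remove∣ z a∈z) ⟩
  length (xs ∖ₗ elems z′) ℕ.+ suc ∣ z′ ∣ₛ  ≡⟨ ℕP.+-suc _ _ ⟩
  suc (length (xs ∖ₗ elems z′) ℕ.+ ∣ z′ ∣ₛ) ≤⟨ s≤s (length-∖ₗ+∣∣≤ xs z′ z′⊆xs) ⟩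
  suc (length xs)                          ∎
  where
  open ℕP.≤-Reasoning
  z′ : FinSet
  z′ = remove a z
  z′⊆xs : ∀ c → c ∈ₛ z′ → c ∈ xs
  z′⊆xs c c∈ = Any.tail (λ { refl → ∉-remove z c∈ }) (z⊆ c (remove-⊆ z c c∈))

∣∖∣+∣∣≤∣∣ : ∀ x z → z ⊆ₛ x → ∣ x ∖ z ∣ₛ ℕ.+ ∣ z ∣ₛ ℕ.≤ ∣ x ∣ₛ
∣∖∣+∣∣≤∣∣ x = length-∖ₗ+∣∣≤ (elems x)

i+j≤k⇒i≤k-j : ∀ {i j k} → i ℤ.+ j ℤ.≤ k → i ℤ.≤ k ℤ.- j
i+j≤k⇒i≤k-j {i} {j} i+j≤k = subst (ℤ._≤ _) (i+j-j≡i i j) (ℤP.+-monoˡ-≤ (ℤ.- j) i+j≤k)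
  where
  i+j-j≡i : ∀ i j → (i ℤ.+ j) ℤ.- j ≡ i
  i+j-j≡i = solve-∀

⊆ₛ⇒DN : ∀ {ℓ} x u → x ⊆ₛ u → ℓ ℤ.≤ ℤ.+ ∣ x ∣ₛ → DN (ℤ.+ ∣ u ∣ₛ ℤ.- ℓ) u x
⊆ₛ⇒DN {ℓ} x u x⊆u ℓ≤∣x∣ = x⊆u , i+j≤k⇒i≤k-j {j = ℓ} (ℤP.≤-trans
  (ℤP.+-monoʳ-≤ (ℤ.+ ∣ u ∖ x ∣ₛ) ℓ≤∣x∣) (ℤ.+≤+ (∣∖∣+∣∣≤∣∣ u x x⊆u)))

module OrderedGroupProperties (G : OrderedGroup) where
  open OrderedGroup G
  open IsAbelianGroup isAbelianGroup using (assoc; comm; identityʳ; inverseˡ; inverseʳ)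
  open IsTotalOrder isTotalOrder using () renaming (trans to ≤-trans; antisym to ≤-antisym)
  open ≡-Reasoning

  x-y+y≡x : ∀ x y → (x - y) + y ≡ x
  x-y+y≡x x y = begin
    (x + (- y)) + y ≡⟨ assoc x (- y) y ⟩
    x + ((- y) + y) ≡⟨ cong (x +_) (inverseˡ y) ⟩
    x + 0#        ≡⟨ identityʳ x ⟩
    x             ∎

  x+y-y≡x : ∀ x y → (x + y) - y ≡ x
  x+y-y≡x x y = begin
    (x + y) + (- y) ≡⟨ assoc x y (- y) ⟩
    x + (y + (- y)) ≡⟨ cong (x +_) (inverseʳ y) ⟩
    x + 0#        ≡⟨ identityʳ x ⟩
    x             ∎

  x-y≤1⇒x-1≤y : ∀ {x y} → (x - y) ≤ 1# → (x - 1#) ≤ y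
  x-y≤1⇒x-1≤y {x} {y} x-y≤1 = subst₂ _≤_
    (cong (_- 1#) (x-y+y≡x x y))
    (trans (cong (_- 1#) (comm 1# y)) (x+y-y≡x y 1#))
    (+-monoˡ-≤ (- 1#) (+-monoˡ-≤ y x-y≤1))

  x-1≤x : ∀ x → (x - 1#) ≤ x
  x-1≤x x = x-y≤1⇒x-1≤y (subst (_≤ 1#) (sym (inverseʳ x)) 0≤1)

  ≤ₑ-trans : ∀ {a b c} → a ≤ₑ b → b ≤ₑ c → a ≤ₑ c
  ≤ₑ-trans -∞≤ _ = -∞≤
  ≤ₑ-trans (fin≤fin a≤b) (fin≤fin b≤c) = fin≤fin (≤-trans a≤b b≤c)

  ≤ₑ-antisym : ∀ {a b} → a ≤ₑ b → b ≤ₑ a → a ≡ b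
  ≤ₑ-antisym -∞≤ -∞≤ = refl
  ≤ₑ-antisym (fin≤fin a≤b) (fin≤fin b≤a) = cong fin (≤-antisym a≤b b≤a)

  -1ₑ-≤ₑ : ∀ {a b} → a ≤ₑ b → (a -1ₑ) ≤ₑ b
  -1ₑ-≤ₑ -∞≤ = -∞≤
  -1ₑ-≤ₑ (fin≤fin {a} a≤b) = fin≤fin (≤-trans (x-1≤x a) a≤b)

module Stability (G : OrderedGroup) (f : FinSet → OrderedGroup.R G) where
  open OrderedGroup G
  open OrderedGroupProperties G

  LipschitzOver-⊆ : ∀ {D D′ : FinSet → Set} → (∀ {x} → D x → D′ x) →
    LipschitzOver f D′ → LipschitzOver f D
  LipschitzOver-⊆ D⊆D′ lip x y Dx Dy = lip x y (D⊆D′ Dx) (D⊆D′ Dy)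

  Stable-⊆ : ∀ {ℓ x y} → Stable f ℓ x → y ⊆ₛ x → ℓ ℤ.≤ ℤ.+ ∣ y ∣ₛ → Stable f ℓ y
  Stable-⊆ {x = x} {y} (_ , lip) y⊆x ℓ≤∣y∣ =
    ℓ≤∣y∣ , LipschitzOver-⊆ (λ {z} (z⊆y , ℓ≤∣z∣) → ⊆ₛ-trans {z} {y} {x} z⊆y y⊆x , ℓ≤∣z∣) lip

  LipschitzOver-DN⇒Stable : ∀ {ℓ} u → ℓ ℤ.≤ ℤ.+ ∣ u ∣ₛ →
    LipschitzOver f (DN (ℤ.+ ∣ u ∣ₛ ℤ.- ℓ) u) → Stable f ℓ u
  LipschitzOver-DN⇒Stable u ℓ≤∣u∣ lip =
    ℓ≤∣u∣ , LipschitzOver-⊆ (λ {x} (x⊆u , ℓ≤∣x∣) → ⊆ₛ⇒DN x u x⊆u ℓ≤∣x∣) lip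

  MonotoneOver-DN⇒≤ : ∀ {ℓ} x u → ℓ ℤ.≤ ℤ.+ ∣ u ∣ₛ → MonotoneOver f (DN (ℤ.+ ∣ u ∣ₛ ℤ.- ℓ) u) →
    x ⊆ₛ u → ℓ ℤ.≤ ℤ.+ ∣ x ∣ₛ → f x ≤ f u
  MonotoneOver-DN⇒≤ x u ℓ≤∣u∣ mono x⊆u ℓ≤∣x∣ with ⊆ₛ⇒≡⊎⊂ₛ {x} {u} x⊆u
  ... | inj₁ refl = IsTotalOrder.refl isTotalOrder
  ... | inj₂ x⊂u = mono x u (⊆ₛ⇒DN x u x⊆u ℓ≤∣x∣) (⊆ₛ⇒DN u u (⊆ₛ-refl {u}) ℓ≤∣u∣) x⊂u

  S-mono : ∀ {ℓ h h′} u u′ → h ℤ.≤ h′ → u ⊆ₛ u′ → ∀ x → S f ℓ h′ u x → S f ℓ h u′ x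
  S-mono u u′ h≤h′ u⊆u′ x (x⊆u , h′≤∣x∣ , x-stable) =
    ⊆ₛ-trans {x} {u} {u′} x⊆u u⊆u′ , ℤP.≤-trans h≤h′ h′≤∣x∣ , x-stable

  S-delete : ∀ {ℓ h} u v → ℓ ℤ.≤ h → Inserts v u → ∀ x → S f ℓ (h ℤ.+ ℤ.+ 1) u x →
    ∃[ y ] (S f ℓ h v y × (f x - 1#) ≤ f y)
  S-delete {ℓ} {h} u v ℓ≤h (a , _ , u≡v+a) x (x⊆u , h+1≤∣x∣ , x-stable) with a ∈? elems x
  ... | no a∉x = x , (x⊆v , h≤∣x∣ , x-stable) , x-1≤x (f x)
    where
    x⊆v : x ⊆ₛ v
    x⊆v = ⊆-Inserts⁻ {u} {v} {x} u≡v+a x⊆u a∉x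
    h≤∣x∣ : h ℤ.≤ ℤ.+ ∣ x ∣ₛ
    h≤∣x∣ = ℤP.≤-trans (ℤP.i≤i+j h (ℤ.+ 1)) h+1≤∣x∣
  ... | yes a∈x =
    x-a , (x-a⊆v , h≤∣x-a∣ , Stable-⊆ {x = x} {x-a} x-stable (remove-⊆ x) ℓ≤∣x-a∣) , fx-1≤fx-a
    where
    x-a : FinSet
    x-a = remove a x
    x-a⊆v : x-a ⊆ₛ v
    x-a⊆v = ⊆-Inserts⁻ {u} {v} {x-a} u≡v+a (⊆ₛ-trans {x-a} {x} {u} (remove-⊆ x) x⊆u) (∉-remove x)
    h≤∣x-a∣ : h ℤ.≤ ℤ.+ ∣ x-a ∣ₛ
    h≤∣x-a∣ = i+j≤k⇒i≤k-j (ℤP.≤-trans h+1≤∣x∣ (ℤ.+≤+ (∣remove∣ x a∈x)))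
    ℓ≤∣x-a∣ : ℓ ℤ.≤ ℤ.+ ∣ x-a ∣ₛ
    ℓ≤∣x-a∣ = ℤP.≤-trans ℓ≤h h≤∣x-a∣
    fx-1≤fx-a : (f x - 1#) ≤ f x-a
    fx-1≤fx-a = x-y≤1⇒x-1≤y (proj₂ (proj₂ x-stable x-a x
      (remove-⊆ x , ℓ≤∣x-a∣) (⊆ₛ-refl {x} , proj₁ x-stable) (inj₁ (remove-Inserts x a∈x))))

  module _ (infY : Ext) where

    IsStab-mono : ∀ {ℓ h ℓ′ h′ s t} u v → (∀ x → S f ℓ h u x → S f ℓ′ h′ v x) →
      IsStab f infY ℓ h u s → IsStab f infY ℓ′ h′ v t → s ≤ₑ t
    IsStab-mono _ _ _ (inj₁ refl , _) (_ , infY≤t , _) = infY≤t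
    IsStab-mono _ _ S⊆S′ (inj₂ (x , x∈S , refl) , _) (_ , _ , ub) = ub x (S⊆S′ x x∈S)

    IsStab-pred-mono : ∀ {ℓ h ℓ′ h′ s t} u v →
      (∀ x → S f ℓ h u x → ∃[ y ] (S f ℓ′ h′ v y × (f x - 1#) ≤ f y)) →
      IsStab f infY ℓ h u s → IsStab f infY ℓ′ h′ v t → (s -1ₑ) ≤ₑ t
    IsStab-pred-mono _ _ _ (inj₁ refl , _) (_ , infY≤t , _) = -1ₑ-≤ₑ infY≤t
    IsStab-pred-mono _ _ dominated (inj₂ (x , x∈S , refl) , _) (_ , _ , ub) =
      let (y , y∈S′ , fx-1≤fy) = dominated x x∈S in ≤ₑ-trans (fin≤fin fx-1≤fy) (ub y y∈S′)

    IsStab-attained : ∀ {ℓ h s} u x → infY ≤ₑ fin (f x) → S f ℓ h u x →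
      (∀ y → S f ℓ h u y → f y ≤ f x) → IsStab f infY ℓ h u s → s ≡ fin (f x)
    IsStab-attained _ _ infY≤fx x∈S _ (inj₁ refl , _ , ub) = ≤ₑ-antisym infY≤fx (ub _ x∈S)
    IsStab-attained _ _ _ x∈S maximal (inj₂ (y , y∈S , refl) , _ , ub) =
      ≤ₑ-antisym (fin≤fin (maximal y y∈S)) (ub _ x∈S)

open Defs.OrderedGroup using (R; Ext; fin; _≤ₑ_; _-1ₑ; IsInf; IsStab; LipschitzOver; MonotoneOver)
open import Data.Integer using (ℤ; _≤_; _+_; +_; _-_)

lemma4p4 :
  (G : OrderedGroup) →
  (𝒴 : R G → Set) (infY : Ext G) → IsInf G 𝒴 infY →
  (f : FinSet → R G) → (∀ x → 𝒴 (f x)) →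
  (ℓ h : ℤ) → ℓ ≤ h →
  ((∀ u s s′ → IsStab G f infY ℓ h u s → IsStab G f infY ℓ (h + + 1) u s′ →
       _≤ₑ_ G s′ s)
  × (∀ u v → Neighbors u v → v ⊂ₛ u → ∀ a b c →
       IsStab G f infY ℓ (h + + 1) u a → IsStab G f infY ℓ h v b →
       IsStab G f infY ℓ h u c →
       _≤ₑ_ G (_-1ₑ G a) b × _≤ₑ_ G b c)
  × (∀ u → h ≤ + ∣ u ∣ₛ →
       LipschitzOver G f (DN (+ ∣ u ∣ₛ - ℓ) u) →
       MonotoneOver G f (DN (+ ∣ u ∣ₛ - ℓ) u) →
       ∀ s → IsStab G f infY ℓ h u s → s ≡ fin (f u)))
lemma4p4 G 𝒴 infY (infY≤𝒴 , _) f f∈𝒴 ℓ h ℓ≤h =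
    (λ u _ _ stab-h stab-h+1 →
      IsStab-mono infY u u (S-mono u u (ℤP.i≤i+j h (+ 1)) (⊆ₛ-refl {u})) stab-h+1 stab-h)
  , (λ u v u~v v⊂u _ _ _ stab-u-h+1 stab-v stab-u →
        IsStab-pred-mono infY u v (S-delete u v ℓ≤h (Neighbors-⊂ₛ⇒Inserts {u} {v} u~v v⊂u))
          stab-u-h+1 stab-v
      , IsStab-mono infY v u (S-mono v u ℤP.≤-refl (proj₁ v⊂u)) stab-v stab-u)
  , λ u h≤∣u∣ lip mono _ stab →
      let ℓ≤∣u∣ = ℤP.≤-trans ℓ≤h h≤∣u∣ in
      IsStab-attained infY u u (infY≤𝒴 (f u) (f∈𝒴 u))
        (⊆ₛ-refl {u} , h≤∣u∣ , LipschitzOver-DN⇒Stable u ℓ≤∣u∣ lip)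
        (λ x (x⊆u , _ , ℓ≤∣x∣ , _) → MonotoneOver-DN⇒≤ x u ℓ≤∣u∣ mono x⊆u ℓ≤∣x∣)
        stab
  where open Stability G f
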